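{- For all integers $b$, $m\ge 0$ and $k\ge1$, and for any choice of the integers $c_b(p_ip_j)$ as described in the context, $$\varphi(b,m,k)=m-\sum_{i=1}^{k}F_{b,m}(p_i)+\sum_{j=2}^{k}F_{b,m}(2p_j)+\sum_{i=2}^{k-1}\sum_{j=i+1}^{k}\varphi\bigl(c_b(p_ip_j),\,F_{b,m}(p_ip_j),\,i-1\bigr).$$
   Context: $p_i$ denotes the $i$-th prime ($p_1=2$) and $P_k=p_1\cdots p_k$. For integers $b$, $m\ge0$, $d\ge1$, $F_{b,m}(d)$ is the number of integers $a$ with $b<a\le b+m$ and $d\mid a$. For integers $c$, $n\ge 0$, $t\ge1$, $\varphi(c,n,t)$ is the number of integers $a$ with $c<a\le c+n$ and $\gcd(a,P_t)=1$ (so $\varphi(c,0,t)=0$). For $2\le i<j$ and $d=p_ip_j$ (with $b,m$ fixed): if $F_{b,m}(d)\ge1$, let $y+d$ be the smallest integer in $\{b+1,\dots,b+m\}$ divisible by $d$; then $c_b(d)$ denotes an integer such that $\gcd(c_b(d)+x,P_{i-1})=\gcd(y+xd,P_{i-1})$ for all integers $x$ (such an integer exists). If $F_{b,m}(d)=0$, $c_b(d)$ is an arbitrary integer (the corresponding term is $0$). -}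

module Defs where

open import Data.Nat as ℕ using (ℕ; zero; suc; _∸_; _!)
open import Data.Nat.Primality using (prime?)
import Data.Nat.Divisibility as ℕD
open import Data.Integer as ℤ using (ℤ; +_; ∣_∣)
open import Data.Integer.Divisibility using (_∣_)
open import Data.Integer.GCD using (gcd)
open import Relation.Nullary using (Dec; yes; no; ¬_)
open import Relation.Binary.PropositionalEquality using (_≡_)
open import Data.Product using (_×_)
open import Data.Integer using (_≟_)

searchPrime : ℕ → ℕ → ℕ
searchPrime a zero = a
searchPrime a (suc f) with prime? a
... | yes _ = a
... | no  _ = searchPrime (suc a) f

-- Smallest prime > n.  A prime factor of n!+1 exceeds n, so the search
-- over n+1, ..., n+1+n! always finds it.
nextPrime : ℕ → ℕ
nextPrime n = searchPrime (suc n) (n !)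

-- p i = i-th prime for i ≥ 1 (p 1 = 2); p 0 = 1 is an unused dummy.
p : ℕ → ℕ
p zero = 1
p (suc i) = nextPrime (p i)

P : ℕ → ℕ
P zero = 1
P (suc t) = P t ℕ.* p (suc t)

countIn : {Q : ℤ → Set} → (∀ a → Dec (Q a)) → ℤ → ℕ → ℕ
countIn Q? b zero = 0
countIn Q? b (suc m) with Q? (b ℤ.+ + suc m)
... | yes _ = suc (countIn Q? b m)
... | no  _ = countIn Q? b m

F : ℤ → ℕ → ℕ → ℕ
F b m d = countIn (λ a → ℕD._∣?_ d ∣ a ∣) b m

φ : ℤ → ℕ → ℕ → ℕ
φ c n t = countIn (λ a → gcd a (+ P t) ≟ + 1) c n

sumFT : ℕ → ℕ → (ℕ → ℕ) → ℕ
sumFT lo hi f = go (suc hi ∸ lo)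
  where
  go : ℕ → ℕ
  go zero = 0
  go (suc r) = go r ℕ.+ f (lo ℕ.+ r)

IsFirstMultiple : ℤ → ℕ → ℕ → ℤ → Set
IsFirstMultiple b m d y =
  (b ℤ.< y ℤ.+ + d) × (y ℤ.+ + d ℤ.≤ b ℤ.+ + m) × (+ d ∣ y ℤ.+ + d) ×
  (∀ a → b ℤ.< a → a ℤ.< y ℤ.+ + d → ¬ (+ d ∣ a))

-- the defining property of c_b(p_i p_j) (vacuous when F_{b,m}(p_i p_j) = 0)
IsCb : ℤ → ℕ → ℕ → ℕ → ℤ → Set
IsCb b m i j c = ∀ y → IsFirstMultiple b m (p i ℕ.* p j) y →
  ∀ x → gcd (c ℤ.+ x) (+ P (i ∸ 1)) ≡ gcd (y ℤ.+ x ℤ.* + (p i ℕ.* p j)) (+ P (i ∸ 1))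

{-# OPTIONS --safe #-}
-- For a single integer a write G t a = [gcd(a, P t) = 1] and D d a = [d ∣ a]. Legendre's
-- recursion G (t+1) = G t − D (p (t+1)) · G t, together with the classification of the multiples
-- of p j by their least prime factor p l (l < j), telescopes to the pointwise identity
--   G k + Σ_{i ≤ k} D (p i) = 1 + Σ_{2 ≤ j ≤ k} D (2 p j) + Σ_{2 ≤ i < j ≤ k} D (p i p j) · G (i − 1).
-- Summing it over b < a ≤ b + m gives the theorem: the multiples of d = p i p j in that interval
-- are y + d, y + 2d, …, y + F d with y = d ⌊b / d⌋, and the defining property of c_b(d) turns
-- the number of them coprime to P (i − 1) into φ(c_b(d), F, i − 1).
module Submission where

open import Defs
open import Data.Nat as ℕ
  using (ℕ; zero; suc; _+_; _*_; _∸_; _≤_; _<_; _!; z≤n; s≤s; s≤s⁻¹;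
         NonZero; ≢-nonZero⁻¹; >-nonZero⁻¹; _≤?_; _<?_)
open import Data.Nat.Properties
open import Data.Nat.Divisibility
  using (_∣_; divides; _∣?_; ∣⇒≤; ∣1⇒≡1; ∣m+n∣m⇒∣n; m≤n⇒m!∣n!; ∣-trans; m∣m*n; n∣m*n; *-monoˡ-∣)
open import Data.Nat.Coprimality using (Coprime; coprime?; coprime-divisor; coprime⇒gcd≡1; gcd≡1⇒coprime)
open import Data.Nat.ListAction using (product)
open import Data.Nat.Primality
open import Data.Nat.Primality.Factorisation using (factorise)
open import Data.Nat.Tactic.RingSolver using (solve-∀)
open import Algebra.Properties.CommutativeSemigroup +-commutativeSemigroup
  using (x∙yz≈xz∙y; xy∙z≈xz∙y) renaming (interchange to +-interchange)
open import Data.Integer as ℤ using (ℤ; +_; ∣_∣; +<+; +≤+)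
import Data.Integer.Properties as ℤ
import Data.Integer.Divisibility.Signed as Signed
import Data.Integer.DivMod as ℤ
open import Data.Integer.GCD using (gcd)
import Data.Integer.Tactic.RingSolver as ℤ-Solver
open import Data.List.Base using ([]; _∷_)
open import Data.List.Relation.Unary.All using (_∷_)
open import Data.Product using (_×_; _,_; ∃; ∃-syntax; proj₁; proj₂)
open import Data.Sum using (inj₁; inj₂)
open import Relation.Nullary using (Dec; yes; no; ¬_; contradiction)
open import Relation.Binary.PropositionalEquality

-- Finite sums

sumFrom : ℕ → ℕ → (ℕ → ℕ) → ℕ
sumFrom lo zero    f = 0
sumFrom lo (suc n) f = sumFrom lo n f + f (lo + n)

sumFrom-cong : ∀ lo n {f g : ℕ → ℕ} → (∀ r → r < n → f (lo + r) ≡ g (lo + r)) →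
               sumFrom lo n f ≡ sumFrom lo n g
sumFrom-cong lo zero    eq = refl
sumFrom-cong lo (suc n) eq =
  cong₂ _+_ (sumFrom-cong lo n (λ r r<n → eq r (m<n⇒m<1+n r<n))) (eq n ≤-refl)

sumFrom-+ : ∀ lo n (f g : ℕ → ℕ) →
            sumFrom lo n (λ i → f i + g i) ≡ sumFrom lo n f + sumFrom lo n g
sumFrom-+ lo zero    f g = refl
sumFrom-+ lo (suc n) f g = trans
  (cong (_+ (f (lo + n) + g (lo + n))) (sumFrom-+ lo n f g))
  (+-interchange (sumFrom lo n f) (sumFrom lo n g) (f (lo + n)) (g (lo + n)))

sumFrom-const : ∀ lo n c → sumFrom lo n (λ _ → c) ≡ n * c
sumFrom-const lo zero    c = refl
sumFrom-const lo (suc n) c = trans (cong (_+ c) (sumFrom-const lo n c)) (+-comm (n * c) c)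

sumFrom-comm : ∀ lo n lo′ n′ (g : ℕ → ℕ → ℕ) →
               sumFrom lo n (λ i → sumFrom lo′ n′ (g i)) ≡
               sumFrom lo′ n′ (λ j → sumFrom lo n (λ i → g i j))
sumFrom-comm lo zero    lo′ n′ g = sym (trans (sumFrom-const lo′ n′ 0) (*-zeroʳ n′))
sumFrom-comm lo (suc n) lo′ n′ g = trans
  (cong (_+ sumFrom lo′ n′ (g (lo + n))) (sumFrom-comm lo n lo′ n′ g))
  (sym (sumFrom-+ lo′ n′ (λ j → sumFrom lo n (λ i → g i j)) (g (lo + n))))

sumFrom-cons : ∀ lo n f → sumFrom lo (suc n) f ≡ f lo + sumFrom (suc lo) n f
sumFrom-cons lo zero    f = trans (cong f (+-identityʳ lo)) (sym (+-identityʳ (f lo)))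
sumFrom-cons lo (suc n) f = trans
  (cong₂ _+_ (sumFrom-cons lo n f) (cong f (+-suc lo n)))
  (+-assoc (f lo) (sumFrom (suc lo) n f) (f (suc lo + n)))

-- The local worker of sumFT cannot be named, so the meta go is solved to it by unification
-- once the number of terms is abstracted to a variable.
sumFT≡sumFrom : ∀ lo hi f → sumFT lo hi f ≡ sumFrom lo (suc hi ∸ lo) f
sumFT≡sumFrom lo hi f = proof
  where
  go : ℕ → ℕ
  go = _
  go≡sumFrom : ∀ n → go n ≡ sumFrom lo n f
  go≡sumFrom zero    = refl
  go≡sumFrom (suc n) = cong (_+ f (lo + n)) (go≡sumFrom n)
  proof : sumFT lo hi f ≡ sumFrom lo (suc hi ∸ lo) f
  proof with suc hi ∸ lo
  ... | n = go≡sumFrom n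

sumFT-empty : ∀ lo hi f → hi < lo → sumFT lo hi f ≡ 0
sumFT-empty lo hi f hi<lo =
  trans (sumFT≡sumFrom lo hi f) (cong (λ n → sumFrom lo n f) (m≤n⇒m∸n≡0 hi<lo))

sumFT-snoc : ∀ lo hi f → lo ≤ suc hi → sumFT lo (suc hi) f ≡ sumFT lo hi f + f (suc hi)
sumFT-snoc lo hi f lo≤ = begin
  sumFT lo (suc hi) f
    ≡⟨ sumFT≡sumFrom lo (suc hi) f ⟩
  sumFrom lo (suc (suc hi) ∸ lo) f
    ≡⟨ cong (λ n → sumFrom lo n f) (+-∸-assoc 1 lo≤) ⟩
  sumFrom lo (suc hi ∸ lo) f + f (lo + (suc hi ∸ lo))
    ≡⟨ cong₂ _+_ (sym (sumFT≡sumFrom lo hi f)) (cong f (m+[n∸m]≡n lo≤)) ⟩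
  sumFT lo hi f + f (suc hi) ∎
  where open ≡-Reasoning

sumFT-snoc-0 : ∀ lo hi f → f (suc hi) ≡ 0 → sumFT lo (suc hi) f ≡ sumFT lo hi f
sumFT-snoc-0 lo hi f f0 with lo ≤? suc hi
... | yes lo≤ = trans (sumFT-snoc lo hi f lo≤) (trans (cong (_+_ (sumFT lo hi f)) f0) (+-identityʳ _))
... | no  lo≰ = trans (sumFT-empty lo (suc hi) f (≰⇒> lo≰))
                      (sym (sumFT-empty lo hi f (<-trans (n<1+n hi) (≰⇒> lo≰))))

sumFT-cons : ∀ lo hi f → lo ≤ hi → sumFT lo hi f ≡ f lo + sumFT (suc lo) hi f
sumFT-cons lo hi f lo≤hi = begin
  sumFT lo hi f                        ≡⟨ sumFT≡sumFrom lo hi f ⟩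
  sumFrom lo (suc hi ∸ lo) f           ≡⟨ cong (λ n → sumFrom lo n f) (+-∸-assoc 1 lo≤hi) ⟩
  sumFrom lo (suc (hi ∸ lo)) f         ≡⟨ sumFrom-cons lo (hi ∸ lo) f ⟩
  f lo + sumFrom (suc lo) (hi ∸ lo) f  ≡⟨ cong (_+_ (f lo)) (sym (sumFT≡sumFrom (suc lo) hi f)) ⟩
  f lo + sumFT (suc lo) hi f           ∎
  where open ≡-Reasoning

sumFT-cong : ∀ lo hi {f g : ℕ → ℕ} → (∀ i → lo ≤ i → i ≤ hi → f i ≡ g i) →
             sumFT lo hi f ≡ sumFT lo hi g
sumFT-cong lo hi {f} {g} eq = begin
  sumFT lo hi f               ≡⟨ sumFT≡sumFrom lo hi f ⟩
  sumFrom lo (suc hi ∸ lo) f  ≡⟨ sumFrom-cong lo (suc hi ∸ lo) (λ r r< → eq (lo + r) (m≤m+n lo r) (inRange r r<)) ⟩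
  sumFrom lo (suc hi ∸ lo) g  ≡⟨ sym (sumFT≡sumFrom lo hi g) ⟩
  sumFT lo hi g               ∎
  where
  open ≡-Reasoning
  inRange : ∀ r → r < suc hi ∸ lo → lo + r ≤ hi
  inRange r r< = subst (_≤ hi) (+-comm r lo) (s≤s⁻¹ (m≤o∸n⇒m+n≤o (suc r) lo≤ r<))
    where
    lo≤ : lo ≤ suc hi
    lo≤ = <⇒≤ (m∸n≢0⇒n<m (λ e → n≮0 (subst (r <_) e r<)))

sumFT-+ : ∀ lo hi (f g : ℕ → ℕ) → sumFT lo hi (λ i → f i + g i) ≡ sumFT lo hi f + sumFT lo hi g
sumFT-+ lo hi f g = begin
  sumFT lo hi (λ i → f i + g i)
    ≡⟨ sumFT≡sumFrom lo hi _ ⟩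
  sumFrom lo (suc hi ∸ lo) (λ i → f i + g i)
    ≡⟨ sumFrom-+ lo (suc hi ∸ lo) f g ⟩
  sumFrom lo (suc hi ∸ lo) f + sumFrom lo (suc hi ∸ lo) g
    ≡⟨ sym (cong₂ _+_ (sumFT≡sumFrom lo hi f) (sumFT≡sumFrom lo hi g)) ⟩
  sumFT lo hi f + sumFT lo hi g ∎
  where open ≡-Reasoning

sumFT-telescope : (g u v : ℕ → ℕ) → (∀ t → g (suc t) + u (suc t) ≡ g t + v (suc t)) →
                  ∀ k → g k + sumFT 1 k u ≡ g 0 + sumFT 1 k v
sumFT-telescope g u v step zero    = refl
sumFT-telescope g u v step (suc k) = begin
  g (suc k) + sumFT 1 (suc k) u        ≡⟨ cong (_+_ (g (suc k))) (sumFT-snoc 1 k u (s≤s z≤n)) ⟩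
  g (suc k) + (sumFT 1 k u + u (suc k)) ≡⟨ x∙yz≈xz∙y (g (suc k)) _ _ ⟩
  g (suc k) + u (suc k) + sumFT 1 k u   ≡⟨ cong (_+ sumFT 1 k u) (step k) ⟩
  g k + v (suc k) + sumFT 1 k u         ≡⟨ xy∙z≈xz∙y (g k) _ _ ⟩
  g k + sumFT 1 k u + v (suc k)         ≡⟨ cong (_+ v (suc k)) (sumFT-telescope g u v step k) ⟩
  g 0 + sumFT 1 k v + v (suc k)         ≡⟨ +-assoc (g 0) _ _ ⟩
  g 0 + (sumFT 1 k v + v (suc k))      ≡⟨ cong (_+_ (g 0)) (sym (sumFT-snoc 1 k v (s≤s z≤n))) ⟩
  g 0 + sumFT 1 (suc k) v              ∎
  where open ≡-Reasoning

sumFT-triangle : ∀ (E : ℕ → ℕ → ℕ) k →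
                 sumFT 1 k (λ j → sumFT 1 (j ∸ 1) (λ l → E l j)) ≡
                 sumFT 2 k (E 1) + sumFT 2 (k ∸ 1) (λ l → sumFT (suc l) k (E l))
sumFT-triangle E zero          = refl
sumFT-triangle E (suc zero)    = refl
sumFT-triangle E (suc (suc k)) = begin
  sumFT 1 (suc K) (λ j → sumFT 1 (j ∸ 1) (λ l → E l j))
    ≡⟨ sumFT-snoc 1 K _ (s≤s z≤n) ⟩
  sumFT 1 K (λ j → sumFT 1 (j ∸ 1) (λ l → E l j)) + sumFT 1 K column
    ≡⟨ cong₂ _+_ (sumFT-triangle E (suc k)) (sumFT-cons 1 K column (s≤s z≤n)) ⟩
  (sumFT 2 K (E 1) + rows K) + (E 1 (suc K) + sumFT 2 K column)
    ≡⟨ +-interchange (sumFT 2 K (E 1)) _ _ _ ⟩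
  (sumFT 2 K (E 1) + E 1 (suc K)) + (rows K + sumFT 2 K column)
    ≡⟨ cong₂ _+_ (sym (sumFT-snoc 2 K (E 1) (s≤s (s≤s z≤n)))) (sym rows-suc) ⟩
  sumFT 2 (suc K) (E 1) + rows (suc K) ∎
  where
  open ≡-Reasoning
  K : ℕ
  K = suc k
  column : ℕ → ℕ
  column l = E l (suc K)
  rows : ℕ → ℕ
  rows n = sumFT 2 (n ∸ 1) (λ l → sumFT (suc l) n (E l))
  rows-suc : rows (suc K) ≡ rows K + sumFT 2 K column
  rows-suc = begin
    sumFT 2 K (λ l → sumFT (suc l) (suc K) (E l))
      ≡⟨ sumFT-cong 2 K (λ l _ l≤K → sumFT-snoc (suc l) K (E l) (s≤s l≤K)) ⟩
    sumFT 2 K (λ l → sumFT (suc l) K (E l) + column l)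
      ≡⟨ sumFT-+ 2 K _ column ⟩
    sumFT 2 K (λ l → sumFT (suc l) K (E l)) + sumFT 2 K column
      ≡⟨ cong (_+ sumFT 2 K column) (sumFT-snoc-0 2 k _ (sumFT-empty (suc K) K (E K) (n<1+n K))) ⟩
    rows K + sumFT 2 K column ∎

-- Counting in an interval

intervalSum : ℤ → ℕ → (ℤ → ℕ) → ℕ
intervalSum b m h = sumFrom 1 m (λ t → h (b ℤ.+ + t))

⟦_⟧ : ∀ {A : Set} → Dec A → ℕ
⟦ yes _ ⟧ = 1
⟦ no  _ ⟧ = 0

⟦⟧-yes : ∀ {A : Set} (A? : Dec A) → A → ⟦ A? ⟧ ≡ 1
⟦⟧-yes (yes _) _ = refl
⟦⟧-yes (no ¬a) a = contradiction a ¬a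

⟦⟧-no : ∀ {A : Set} (A? : Dec A) → ¬ A → ⟦ A? ⟧ ≡ 0
⟦⟧-no (yes a) ¬a = contradiction a ¬a
⟦⟧-no (no _)  _  = refl

countIn≡intervalSum : ∀ {Q : ℤ → Set} (Q? : ∀ a → Dec (Q a)) b m →
                      countIn Q? b m ≡ intervalSum b m (λ a → ⟦ Q? a ⟧)
countIn≡intervalSum Q? b zero = refl
countIn≡intervalSum Q? b (suc m) with Q? (b ℤ.+ + suc m)
... | yes _ = trans (cong suc (countIn≡intervalSum Q? b m)) (+-comm 1 _)
... | no  _ = trans (countIn≡intervalSum Q? b m) (sym (+-identityʳ _))

intervalSum-sumFT : ∀ b m lo hi (g : ℕ → ℤ → ℕ) →
                    intervalSum b m (λ a → sumFT lo hi (λ i → g i a)) ≡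
                    sumFT lo hi (λ i → intervalSum b m (g i))
intervalSum-sumFT b m lo hi g = begin
  intervalSum b m (λ a → sumFT lo hi (λ i → g i a))
    ≡⟨ sumFrom-cong 1 m (λ t _ → sumFT≡sumFrom lo hi (λ i → g i (b ℤ.+ + suc t))) ⟩
  sumFrom 1 m (λ t → sumFrom lo (suc hi ∸ lo) (λ i → g i (b ℤ.+ + t)))
    ≡⟨ sumFrom-comm 1 m lo (suc hi ∸ lo) (λ t i → g i (b ℤ.+ + t)) ⟩
  sumFrom lo (suc hi ∸ lo) (λ i → intervalSum b m (g i))
    ≡⟨ sym (sumFT≡sumFrom lo hi _) ⟩
  sumFT lo hi (λ i → intervalSum b m (g i)) ∎
  where open ≡-Reasoning

i<i+n : ∀ i {n} → 0 < n → i ℤ.< i ℤ.+ + n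
i<i+n i 0<n = subst (ℤ._< i ℤ.+ _) (ℤ.+-identityʳ i) (ℤ.+-monoʳ-< i (+<+ 0<n))

countIn-witness : ∀ {Q : ℤ → Set} (Q? : ∀ a → Dec (Q a)) b m → 0 < countIn Q? b m →
                  ∃[ a ] b ℤ.< a × a ℤ.≤ b ℤ.+ + m × Q a
countIn-witness Q? b (suc m) pos with Q? (b ℤ.+ + suc m)
... | yes q = b ℤ.+ + suc m , i<i+n b (s≤s z≤n) , ℤ.≤-refl , q
... | no  _ with countIn-witness Q? b m pos
...   | a , b<a , a≤b+m , q = a , b<a , ℤ.≤-trans a≤b+m (ℤ.+-monoʳ-≤ b (+≤+ (n≤1+n m))) , q

-- The primes p i

searchPrime-≥ : ∀ a f → a ≤ searchPrime a f
searchPrime-≥ a zero    = ≤-refl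
searchPrime-≥ a (suc f) with prime? a
... | yes _ = ≤-refl
... | no  _ = ≤-trans (n≤1+n a) (searchPrime-≥ (suc a) f)

searchPrime-prime : ∀ a f {q} → Prime q → a ≤ q → q ≤ a + f → Prime (searchPrime a f)
searchPrime-prime a zero    {q} pq a≤q q≤a+0 =
  subst Prime (≤-antisym (subst (q ≤_) (+-identityʳ a) q≤a+0) a≤q) pq
searchPrime-prime a (suc f) {q} pq a≤q q≤ with prime? a
... | yes pa  = pa
... | no  ¬pa = searchPrime-prime (suc a) f pq
                  (≤∧≢⇒< a≤q (λ a≡q → ¬pa (subst Prime (sym a≡q) pq)))
                  (subst (q ≤_) (+-suc a f) q≤)

primeDivisor-suc : ∀ m .{{_ : NonZero m}} → ∃[ q ] Prime q × q ∣ suc m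
primeDivisor-suc m with factorise (suc m)
... | record { factors = [] ; isFactorisation = eq } =
  contradiction (suc-injective eq) (≢-nonZero⁻¹ m)
... | record { factors = q ∷ qs ; isFactorisation = eq ; factorsPrime = pq ∷ _ } =
  q , pq , divides (product qs) (trans eq (*-comm q (product qs)))

0<m≤n⇒m∣n! : ∀ {m n} → 0 < m → m ≤ n → m ∣ n !
0<m≤n⇒m∣n! {suc m} _ m<n = ∣-trans (m∣m*n (m !)) (m≤n⇒m!∣n! m<n)

-- A prime divisor q of n ! + 1 exceeds n, for otherwise q ∣ n ! and hence q ∣ 1.
nextPrime-prime : ∀ n → Prime (nextPrime n)
nextPrime-prime n with primeDivisor-suc (n !) {{n !≢0}}
... | q , pq , q∣n!+1 =
  searchPrime-prime (suc n) (n !) pq n<q (≤-trans (∣⇒≤ q∣n!+1) (s≤s (m≤n+m (n !) n)))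
  where
  n<q : n < q
  n<q with n <? q
  ... | yes n<q = n<q
  ... | no  n≮q = contradiction (subst Prime (∣1⇒≡1 q∣1) pq) ¬prime[1]
    where
    q∣1 : q ∣ 1
    q∣1 = ∣m+n∣m⇒∣n (subst (q ∣_) (+-comm 1 (n !)) q∣n!+1)
                     (0<m≤n⇒m∣n! (>-nonZero⁻¹ q {{prime⇒nonZero pq}}) (≮⇒≥ n≮q))

p-prime : ∀ i → Prime (p (suc i))
p-prime i = nextPrime-prime (p i)

p<p[1+i] : ∀ i → p i < p (suc i)
p<p[1+i] i = searchPrime-≥ (suc (p i)) (p i !)

p-strictlyIncreasing : ∀ {i j} → i < j → p i < p j
p-strictlyIncreasing {i} {suc j} (s≤s i≤j) with m≤n⇒m<n∨m≡n i≤j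
... | inj₁ i<j  = <-trans (p-strictlyIncreasing i<j) (p<p[1+i] j)
... | inj₂ refl = p<p[1+i] j

p-nonZero : ∀ i → NonZero (p i)
p-nonZero zero    = _
p-nonZero (suc i) = prime⇒nonZero (p-prime i)

-- The sieve identity for a single integer

divisorIndicator : ℕ → ℤ → ℕ
divisorIndicator d a = ⟦ d ∣? ∣ a ∣ ⟧

coprimeIndicator : ℕ → ℤ → ℕ
coprimeIndicator n a = ⟦ gcd a (+ n) ℤ.≟ + 1 ⟧

coprimeIndicator-coprime : ∀ n a → Coprime ∣ a ∣ n → coprimeIndicator n a ≡ 1
coprimeIndicator-coprime n a cop = ⟦⟧-yes (gcd a (+ n) ℤ.≟ + 1) (cong +_ (coprime⇒gcd≡1 cop))

coprimeIndicator-¬coprime : ∀ n a → ¬ Coprime ∣ a ∣ n → coprimeIndicator n a ≡ 0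
coprimeIndicator-¬coprime n a ¬cop =
  ⟦⟧-no (gcd a (+ n) ℤ.≟ + 1) (λ gcd≡1 → ¬cop (gcd≡1⇒coprime (ℤ.+-injective gcd≡1)))

coprimeIndicator-1 : ∀ a → coprimeIndicator 1 a ≡ 1
coprimeIndicator-1 a = coprimeIndicator-coprime 1 a (λ (_ , d∣1) → ∣1⇒≡1 d∣1)

coprime-*ˡ : ∀ {n x} q → Coprime n (x * q) → Coprime n x
coprime-*ˡ q cop (d∣n , d∣x) = cop (d∣n , ∣-trans d∣x (m∣m*n q))

coprime-*-prime⇒∤ : ∀ {n x q} → Prime q → Coprime n (x * q) → ¬ q ∣ n
coprime-*-prime⇒∤ {x = x} pq cop q∣n = ¬prime[1] (subst Prime (cop (q∣n , n∣m*n x)) pq)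

coprime∧∤⇒coprime-*-prime : ∀ {n x q} → Prime q → Coprime n x → ¬ q ∣ n → Coprime n (x * q)
coprime∧∤⇒coprime-*-prime {n} {x} {q} pq cop q∤n {d} (d∣n , d∣xq)
  with prime⇒irreducible pq (coprime-divisor (λ (e∣d , e∣x) → cop (∣-trans e∣d d∣n , e∣x)) d∣xq)
... | inj₁ d≡1 = d≡1
... | inj₂ refl = contradiction d∣n q∤n

-- a is coprime to x q iff it is coprime to x and q ∤ a.
coprimeIndicator-*-prime : ∀ {q} x a → Prime q →
  coprimeIndicator (x * q) a + divisorIndicator q a * coprimeIndicator x a ≡ coprimeIndicator x a
coprimeIndicator-*-prime {q} x a pq with coprime? ∣ a ∣ x | q ∣? ∣ a ∣
... | yes cop | yes q∣a
  rewrite coprimeIndicator-¬coprime (x * q) a (λ cop′ → coprime-*-prime⇒∤ {x = x} pq cop′ q∣a)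
        | coprimeIndicator-coprime x a cop = refl
... | yes cop | no q∤a
  rewrite coprimeIndicator-coprime (x * q) a (coprime∧∤⇒coprime-*-prime pq cop q∤a)
        | coprimeIndicator-coprime x a cop = refl
... | no ¬cop | q∣a?
  rewrite coprimeIndicator-¬coprime (x * q) a (λ cop′ → ¬cop (coprime-*ˡ {x = x} q cop′))
        | coprimeIndicator-¬coprime x a ¬cop = *-zeroʳ ⟦ q∣a? ⟧

distinctPrimes-∣⇒*∣ : ∀ {q r n} → Prime q → Prime r → q ≢ r → q ∣ n → r ∣ n → q * r ∣ n
distinctPrimes-∣⇒*∣ {q} {r} pq pr q≢r q∣n (divides k refl) with euclidsLemma k r pq q∣n
... | inj₁ q∣k = *-monoˡ-∣ r q∣k
... | inj₂ q∣r with prime⇒irreducible pr q∣r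
...   | inj₁ q≡1 = contradiction (subst Prime q≡1 pq) ¬prime[1]
...   | inj₂ q≡r = contradiction q≡r q≢r

divisorIndicator-*-distinctPrimes : ∀ {q r} a → Prime q → Prime r → q ≢ r →
  divisorIndicator q a * divisorIndicator r a ≡ divisorIndicator (q * r) a
divisorIndicator-*-distinctPrimes {q} {r} a pq pr q≢r with q ∣? ∣ a ∣ | r ∣? ∣ a ∣
... | yes q∣a | yes r∣a = sym (⟦⟧-yes (q * r ∣? ∣ a ∣) (distinctPrimes-∣⇒*∣ pq pr q≢r q∣a r∣a))
... | yes _   | no  r∤a = sym (⟦⟧-no (q * r ∣? ∣ a ∣) (λ qr∣a → r∤a (∣-trans (n∣m*n q) qr∣a)))
... | no  q∤a | _       = sym (⟦⟧-no (q * r ∣? ∣ a ∣) (λ qr∣a → q∤a (∣-trans (m∣m*n r) qr∣a)))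

sieveTerm : ℕ → ℕ → ℤ → ℕ
sieveTerm l j a = divisorIndicator (p l * p j) a * coprimeIndicator (P (l ∸ 1)) a

-- Classifies the multiples of p j by their least prime factor p l with l ≤ t, if there is one.
divisorIndicator-expansion : ∀ t j a → t < j →
  divisorIndicator (p j) a ≡
  divisorIndicator (p j) a * coprimeIndicator (P t) a + sumFT 1 t (λ l → sieveTerm l j a)
divisorIndicator-expansion zero j a _ =
  sym (trans (+-identityʳ _) (trans (cong (D *_) (coprimeIndicator-1 a)) (*-identityʳ D)))
  where
  D : ℕ
  D = divisorIndicator (p j) a
divisorIndicator-expansion (suc t) (suc j) a (s≤s t<j) = begin
  D
    ≡⟨ divisorIndicator-expansion t (suc j) a (m<n⇒m<1+n t<j) ⟩
  D * G + S
    ≡⟨ cong (λ g → D * g + S) (sym (coprimeIndicator-*-prime (P t) a (p-prime t))) ⟩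
  D * (G′ + Dₜ * G) + S
    ≡⟨ rearrange D G′ Dₜ G S ⟩
  D * G′ + (S + Dₜ * D * G)
    ≡⟨ cong (λ e → D * G′ + (S + e * G)) dₜd≡ ⟩
  D * G′ + (S + sieveTerm (suc t) (suc j) a)
    ≡⟨ cong (_+_ (D * G′)) (sym (sumFT-snoc 1 t _ (s≤s z≤n))) ⟩
  D * G′ + sumFT 1 (suc t) (λ l → sieveTerm l (suc j) a) ∎
  where
  open ≡-Reasoning
  D Dₜ G G′ S : ℕ
  D = divisorIndicator (p (suc j)) a
  Dₜ = divisorIndicator (p (suc t)) a
  G = coprimeIndicator (P t) a
  G′ = coprimeIndicator (P (suc t)) a
  S = sumFT 1 t (λ l → sieveTerm l (suc j) a)
  rearrange : ∀ d g′ e g s → d * (g′ + e * g) + s ≡ d * g′ + (s + e * d * g)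
  rearrange = solve-∀
  dₜd≡ : Dₜ * D ≡ divisorIndicator (p (suc t) * p (suc j)) a
  dₜd≡ = divisorIndicator-*-distinctPrimes a (p-prime t) (p-prime j)
           (<⇒≢ (p-strictlyIncreasing (s≤s t<j)))

coprimeIndicator-suc : ∀ t a →
  coprimeIndicator (P (suc t)) a + divisorIndicator (p (suc t)) a ≡
  coprimeIndicator (P t) a + sumFT 1 t (λ l → sieveTerm l (suc t) a)
coprimeIndicator-suc t a = begin
  G′ + D            ≡⟨ cong (_+_ G′) (divisorIndicator-expansion t (suc t) a (n<1+n t)) ⟩
  G′ + (D * G + S)  ≡⟨ sym (+-assoc G′ (D * G) S) ⟩
  G′ + D * G + S    ≡⟨ cong (_+ S) (coprimeIndicator-*-prime (P t) a (p-prime t)) ⟩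
  G + S             ∎
  where
  open ≡-Reasoning
  D G G′ S : ℕ
  D = divisorIndicator (p (suc t)) a
  G = coprimeIndicator (P t) a
  G′ = coprimeIndicator (P (suc t)) a
  S = sumFT 1 t (λ l → sieveTerm l (suc t) a)

sieveIdentity : ∀ k a →
  coprimeIndicator (P k) a + sumFT 1 k (λ i → divisorIndicator (p i) a) ≡
  1 + (sumFT 2 k (λ j → divisorIndicator (2 * p j) a) +
       sumFT 2 (k ∸ 1) (λ l → sumFT (suc l) k (λ j → sieveTerm l j a)))
sieveIdentity k a = begin
  coprimeIndicator (P k) a + sumFT 1 k (λ i → divisorIndicator (p i) a)
    ≡⟨ sumFT-telescope (λ t → coprimeIndicator (P t) a) (λ i → divisorIndicator (p i) a)
         (λ j → sumFT 1 (j ∸ 1) (λ l → sieveTerm l j a)) (λ t → coprimeIndicator-suc t a) k ⟩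
  coprimeIndicator 1 a + sumFT 1 k (λ j → sumFT 1 (j ∸ 1) (λ l → sieveTerm l j a))
    ≡⟨ cong₂ _+_ (coprimeIndicator-1 a) (sumFT-triangle (λ l j → sieveTerm l j a) k) ⟩
  1 + (sumFT 2 k (λ j → sieveTerm 1 j a) + T)
    ≡⟨ cong (λ s → 1 + (s + T)) (sumFT-cong 2 k (λ j _ _ →
         trans (cong (divisorIndicator (2 * p j) a *_) (coprimeIndicator-1 a)) (*-identityʳ _))) ⟩
  1 + (sumFT 2 k (λ j → divisorIndicator (2 * p j) a) + T) ∎
  where
  open ≡-Reasoning
  T : ℕ
  T = sumFT 2 (k ∸ 1) (λ l → sumFT (suc l) k (λ j → sieveTerm l j a))

-- Multiples of d in an interval

IsFloorMultiple : ℕ → ℤ → ℤ → Set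
IsFloorMultiple d b y = d ∣ ∣ y ∣ × y ℤ.≤ b × b ℤ.< y ℤ.+ + d

∣⇒∣+self : ∀ {d y} → d ∣ ∣ y ∣ → d ∣ ∣ y ℤ.+ + d ∣
∣⇒∣+self {d} {y} d∣y =
  Signed.∣⇒∣ᵤ {+ d} {y ℤ.+ + d} (Signed.∣m∣n⇒∣m+n (Signed.∣ᵤ⇒∣ {+ d} {y} d∣y) Signed.∣-refl)

multiple-gap : ∀ {d u v} → d ∣ ∣ u ∣ → d ∣ ∣ v ∣ → u ℤ.< v → u ℤ.+ + d ℤ.≤ v
multiple-gap {d} {u} {v} d∣u d∣v u<v = begin
  u ℤ.+ + d          ≤⟨ ℤ.+-monoʳ-≤ u (d≤ (v ℤ.- u) 0<v-u d∣v-u) ⟩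
  u ℤ.+ (v ℤ.- u)    ≡⟨ cancel u v ⟩
  v                  ∎
  where
  open ℤ.≤-Reasoning
  0<v-u : ℤ.0ℤ ℤ.< v ℤ.- u
  0<v-u = subst (ℤ._< v ℤ.- u) (ℤ.+-inverseʳ u) (ℤ.+-monoˡ-< (ℤ.- u) u<v)
  d∣v-u : d ∣ ∣ v ℤ.- u ∣
  d∣v-u = Signed.∣⇒∣ᵤ {+ d} {v ℤ.- u}
            (Signed.∣m∣n⇒∣m-n (Signed.∣ᵤ⇒∣ {+ d} {v} d∣v) (Signed.∣ᵤ⇒∣ {+ d} {u} d∣u))
  d≤ : ∀ x → ℤ.0ℤ ℤ.< x → d ∣ ∣ x ∣ → + d ℤ.≤ x
  d≤ (+ zero)  (+<+ ()) _
  d≤ (+ suc n) _        d∣x = +≤+ (∣⇒≤ d∣x)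
  cancel : ∀ u v → u ℤ.+ (v ℤ.- u) ≡ v
  cancel = ℤ-Solver.solve-∀

i+[1+m]≡suc[i+m] : ∀ i m → i ℤ.+ + suc m ≡ ℤ.suc (i ℤ.+ + m)
i+[1+m]≡suc[i+m] i m = trans (cong (ℤ._+_ i) (ℤ.pos-+ 1 m)) (shift i (+ m))
  where
  shift : ∀ i x → i ℤ.+ (ℤ.1ℤ ℤ.+ x) ≡ ℤ.1ℤ ℤ.+ (i ℤ.+ x)
  shift = ℤ-Solver.solve-∀

i+m*e+e≡i+[1+m]*e : ∀ i m e → i ℤ.+ + m ℤ.* e ℤ.+ e ≡ i ℤ.+ + suc m ℤ.* e
i+m*e+e≡i+[1+m]*e i m e =
  trans (distrib i (+ m) e) (cong (λ x → i ℤ.+ x ℤ.* e) (sym (ℤ.pos-+ 1 m)))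
  where
  distrib : ∀ i x e → i ℤ.+ x ℤ.* e ℤ.+ e ≡ i ℤ.+ (ℤ.1ℤ ℤ.+ x) ℤ.* e
  distrib = ℤ-Solver.solve-∀

module _ (d : ℕ) .{{_ : NonZero d}} where

  floorMultiple : ∀ b → ∃ (IsFloorMultiple d b)
  floorMultiple b = q ℤ.* + d , d∣qd , ℤ.[n/ℕd]*d≤n b d , b<qd+d
    where
    q : ℤ
    q = b ℤ./ℕ d
    d∣qd : d ∣ ∣ q ℤ.* + d ∣
    d∣qd = Signed.∣⇒∣ᵤ {+ d} {q ℤ.* + d} (Signed.divides q refl)
    b<qd+d : b ℤ.< q ℤ.* + d ℤ.+ + d
    b<qd+d = subst (b ℤ.<_) (distrib q (+ d)) (ℤ.n<s[n/ℕd]*d b d)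
      where
      distrib : ∀ q e → (ℤ.1ℤ ℤ.+ q) ℤ.* e ≡ q ℤ.* e ℤ.+ e
      distrib = ℤ-Solver.solve-∀

  floorMultiple-self : ∀ {a} → d ∣ ∣ a ∣ → IsFloorMultiple d a a
  floorMultiple-self {a} d∣a = d∣a , ℤ.≤-refl , i<i+n a (>-nonZero⁻¹ d)

  floorMultiple-suc-∣ : ∀ {a y} → IsFloorMultiple d a y → d ∣ ∣ ℤ.suc a ∣ → ℤ.suc a ≡ y ℤ.+ + d
  floorMultiple-suc-∣ (d∣y , y≤a , a<y+d) d∣a+1 = ℤ.≤-antisym
    (ℤ.i<j⇒suc[i]≤j a<y+d)
    (multiple-gap d∣y d∣a+1 (ℤ.≤-<-trans y≤a (ℤ.suc[i]≤j⇒i<j ℤ.≤-refl)))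

  floorMultiple-suc-∤ : ∀ {a y} → IsFloorMultiple d a y → ¬ d ∣ ∣ ℤ.suc a ∣ →
                        IsFloorMultiple d (ℤ.suc a) y
  floorMultiple-suc-∤ {a} {y} (d∣y , y≤a , a<y+d) d∤a+1 =
    d∣y , ℤ.≤-trans y≤a (ℤ.i≤suc[i] a) ,
    ℤ.≤∧≢⇒< (ℤ.i<j⇒suc[i]≤j a<y+d)
      (λ a+1≡y+d → d∤a+1 (subst (λ z → d ∣ ∣ z ∣) (sym a+1≡y+d) (∣⇒∣+self {y = y} d∣y)))

  mutual
    floorMultiple-advance : ∀ {b y} m → IsFloorMultiple d b y →
                            IsFloorMultiple d (b ℤ.+ + m) (y ℤ.+ + F b m d ℤ.* + d)
    floorMultiple-advance {b} {y} zero fm =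
      subst₂ (IsFloorMultiple d) (sym (ℤ.+-identityʳ b)) (sym (ℤ.+-identityʳ y)) fm
    floorMultiple-advance {b} {y} (suc m) fm with d ∣? ∣ b ℤ.+ + suc m ∣
    ... | yes d∣b+m+1 =
      subst (IsFloorMultiple d (b ℤ.+ + suc m)) (∣⇒≡nextMultiple m fm d∣b+m+1)
            (floorMultiple-self d∣b+m+1)
    ... | no  d∤b+m+1 =
      subst (λ a → IsFloorMultiple d a (y ℤ.+ + F b m d ℤ.* + d)) (sym (i+[1+m]≡suc[i+m] b m))
        (floorMultiple-suc-∤ (floorMultiple-advance m fm)
          (subst (λ a → ¬ d ∣ ∣ a ∣) (i+[1+m]≡suc[i+m] b m) d∤b+m+1))

    ∣⇒≡nextMultiple : ∀ {b y} m → IsFloorMultiple d b y → d ∣ ∣ b ℤ.+ + suc m ∣ →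
                   b ℤ.+ + suc m ≡ y ℤ.+ + suc (F b m d) ℤ.* + d
    ∣⇒≡nextMultiple {b} {y} m fm d∣b+m+1 = begin
      b ℤ.+ + suc m                          ≡⟨ i+[1+m]≡suc[i+m] b m ⟩
      ℤ.suc (b ℤ.+ + m)                      ≡⟨ floorMultiple-suc-∣ (floorMultiple-advance m fm)
                                                   (subst (λ a → d ∣ ∣ a ∣) (i+[1+m]≡suc[i+m] b m) d∣b+m+1) ⟩
      y ℤ.+ + F b m d ℤ.* + d ℤ.+ + d        ≡⟨ i+m*e+e≡i+[1+m]*e y (F b m d) (+ d) ⟩
      y ℤ.+ + suc (F b m d) ℤ.* + d          ∎
      where open ≡-Reasoning

  intervalSum-multiples : ∀ {b y} (h : ℤ → ℕ) m → IsFloorMultiple d b y →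
    intervalSum b m (λ a → divisorIndicator d a * h a) ≡
    sumFrom 1 (F b m d) (λ x → h (y ℤ.+ + x ℤ.* + d))
  intervalSum-multiples h zero    fm = refl
  intervalSum-multiples {b} h (suc m) fm with d ∣? ∣ b ℤ.+ + suc m ∣
  ... | yes d∣b+m+1 = cong₂ _+_ (intervalSum-multiples h m fm)
                                (trans (*-identityˡ _) (cong h (∣⇒≡nextMultiple m fm d∣b+m+1)))
  ... | no  _       = trans (+-identityʳ _) (intervalSum-multiples h m fm)

  floorMultiple⇒isFirstMultiple : ∀ {b y} m → IsFloorMultiple d b y → 0 < F b m d →
                                  IsFirstMultiple b m d y
  floorMultiple⇒isFirstMultiple {b} {y} m (d∣y , y≤b , b<y+d) 0<F
    with countIn-witness (λ a → d ∣? ∣ a ∣) b m 0<F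
  ... | a , b<a , a≤b+m , d∣a =
    b<y+d ,
    ℤ.≤-trans (multiple-gap d∣y d∣a (ℤ.≤-<-trans y≤b b<a)) a≤b+m ,
    ∣⇒∣+self {y = y} d∣y ,
    λ a′ b<a′ a′<y+d d∣a′ → ℤ.<⇒≱ a′<y+d (multiple-gap d∣y d∣a′ (ℤ.≤-<-trans y≤b b<a′))

intervalSum-sieveTerm : ∀ b m i j c → IsCb b m i j c →
                        intervalSum b m (sieveTerm i j) ≡ φ c (F b m (p i * p j)) (i ∸ 1)
intervalSum-sieveTerm b m i j c isCb = begin
  intervalSum b m (sieveTerm i j)
    ≡⟨ intervalSum-multiples d {{d≢0}} h m fm ⟩
  sumFrom 1 (F b m d) (λ x → h (y ℤ.+ + x ℤ.* + d))
    ≡⟨ sumFrom-cong 1 (F b m d) (λ r r<F → cong (λ g → ⟦ g ℤ.≟ + 1 ⟧)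
         (sym (isCb y (floorMultiple⇒isFirstMultiple d {{d≢0}} m fm (≤-<-trans z≤n r<F)) (+ suc r)))) ⟩
  intervalSum c (F b m d) h
    ≡⟨ sym (countIn≡intervalSum _ c (F b m d)) ⟩
  φ c (F b m d) (i ∸ 1) ∎
  where
  open ≡-Reasoning
  d : ℕ
  d = p i * p j
  d≢0 : NonZero d
  d≢0 = m*n≢0 (p i) (p j) {{p-nonZero i}} {{p-nonZero j}}
  h : ℤ → ℕ
  h = coprimeIndicator (P (i ∸ 1))
  y : ℤ
  y = proj₁ (floorMultiple d {{d≢0}} b)
  fm : IsFloorMultiple d b y
  fm = proj₂ (floorMultiple d {{d≢0}} b)

sieveCount : (b : ℤ) (m k : ℕ) (c : ℕ → ℕ → ℤ) →
  (∀ i j → 2 ≤ i → i < j → j ≤ k → IsCb b m i j (c i j)) →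
  φ b m k + sumFT 1 k (λ i → F b m (p i)) ≡
  m + (sumFT 2 k (λ j → F b m (2 * p j)) +
       sumFT 2 (k ∸ 1) (λ i → sumFT (suc i) k (λ j → φ (c i j) (F b m (p i * p j)) (i ∸ 1))))
sieveCount b m k c isCb = begin
  φ b m k + sumFT 1 k (λ i → F b m (p i))
    ≡⟨ cong₂ _+_ (countIn≡intervalSum _ b m)
         (trans (sumFT-cong 1 k (λ i _ _ → countIn≡intervalSum _ b m))
                (sym (intervalSum-sumFT b m 1 k (λ i → divisorIndicator (p i))))) ⟩
  intervalSum b m (coprimeIndicator (P k)) +
  intervalSum b m (λ a → sumFT 1 k (λ i → divisorIndicator (p i) a))
    ≡⟨ sym (sumFrom-+ 1 m _ _) ⟩
  intervalSum b m (λ a → coprimeIndicator (P k) a + sumFT 1 k (λ i → divisorIndicator (p i) a))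
    ≡⟨ sumFrom-cong 1 m (λ t _ → sieveIdentity k (b ℤ.+ + suc t)) ⟩
  intervalSum b m (λ a → 1 + (S₂ a + S₃ a))
    ≡⟨ trans (sumFrom-+ 1 m _ _)
             (cong₂ _+_ (trans (sumFrom-const 1 m 1) (*-identityʳ m)) (sumFrom-+ 1 m _ _)) ⟩
  m + (intervalSum b m S₂ + intervalSum b m S₃)
    ≡⟨ cong (λ s → m + s) (cong₂ _+_ sum₂ sum₃) ⟩
  m + (sumFT 2 k (λ j → F b m (2 * p j)) +
       sumFT 2 (k ∸ 1) (λ i → sumFT (suc i) k (λ j → φ (c i j) (F b m (p i * p j)) (i ∸ 1)))) ∎
  where
  open ≡-Reasoning
  S₂ S₃ : ℤ → ℕ
  S₂ a = sumFT 2 k (λ j → divisorIndicator (2 * p j) a)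
  S₃ a = sumFT 2 (k ∸ 1) (λ l → sumFT (suc l) k (λ j → sieveTerm l j a))
  sum₂ : intervalSum b m S₂ ≡ sumFT 2 k (λ j → F b m (2 * p j))
  sum₂ = trans (intervalSum-sumFT b m 2 k (λ j → divisorIndicator (2 * p j)))
               (sumFT-cong 2 k (λ j _ _ → sym (countIn≡intervalSum _ b m)))
  sum₃ : intervalSum b m S₃ ≡
         sumFT 2 (k ∸ 1) (λ i → sumFT (suc i) k (λ j → φ (c i j) (F b m (p i * p j)) (i ∸ 1)))
  sum₃ = trans (intervalSum-sumFT b m 2 (k ∸ 1) (λ l a → sumFT (suc l) k (λ j → sieveTerm l j a)))
    (sumFT-cong 2 (k ∸ 1) λ l 2≤l _ →
      trans (intervalSum-sumFT b m (suc l) k (sieveTerm l))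
        (sumFT-cong (suc l) k λ j l<j j≤k → intervalSum-sieveTerm b m l j (c l j) (isCb l j 2≤l l<j j≤k)))

x+a≡m+[b+c]⇒x≡m-a+b+c : ∀ {x a m b c : ℕ} → x + a ≡ m + (b + c) →
                         + x ≡ + m ℤ.- + a ℤ.+ + b ℤ.+ + c
x+a≡m+[b+c]⇒x≡m-a+b+c {x} {a} {m} {b} {c} eq = begin
  + x                                 ≡⟨ add-sub (+ x) (+ a) ⟩
  + x ℤ.+ + a ℤ.- + a                 ≡⟨ cong (ℤ._- + a) (cong +_ eq) ⟩
  + (m + (b + c)) ℤ.- + a             ≡⟨ cong (λ s → + m ℤ.+ s ℤ.- + a) (ℤ.pos-+ b c) ⟩
  + m ℤ.+ (+ b ℤ.+ + c) ℤ.- + a       ≡⟨ reorder (+ m) (+ a) (+ b) (+ c) ⟩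
  + m ℤ.- + a ℤ.+ + b ℤ.+ + c         ∎
  where
  open ≡-Reasoning
  add-sub : ∀ x a → x ≡ x ℤ.+ a ℤ.- a
  add-sub = ℤ-Solver.solve-∀
  reorder : ∀ m a b c → m ℤ.+ (b ℤ.+ c) ℤ.- a ≡ m ℤ.- a ℤ.+ b ℤ.+ c
  reorder = ℤ-Solver.solve-∀

theorem3p4 : (b : ℤ) (m k : ℕ) → 1 ≤ k →
    (c : ℕ → ℕ → ℤ) →
    (∀ i j → 2 ≤ i → i < j → j ≤ k → IsCb b m i j (c i j)) →
    + φ b m k ≡
      + m ℤ.- + sumFT 1 k (λ i → F b m (p i))
        ℤ.+ + sumFT 2 k (λ j → F b m (2 ℕ.* p j))
        ℤ.+ + sumFT 2 (k ∸ 1) (λ i → sumFT (ℕ.suc i) k (λ j →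
              φ (c i j) (F b m (p i ℕ.* p j)) (i ∸ 1)))
theorem3p4 b m k _ c isCb = x+a≡m+[b+c]⇒x≡m-a+b+c (sieveCount b m k c isCb)
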